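{- Let $(\mathscr A,\preceq,\multimap)$ be an implicative structure and fix an interpretation of IMLL formulas in $\mathscr A$. If a formula $A$ is a tautology of IMLL (i.e. the sequent $\vdash A$ is derivable), then $A^{\mathscr A}\in\mathrm{lcore}(\mathscr A)$.
   Context: An implicative structure is a complete lattice $(\mathscr A,\preceq)$ with binary $\multimap$ (right-associative) such that $a'\preceq a$, $b\preceq b'$ imply $(a\multimap b)\preceq(a'\multimap b')$, and $a\multimap\bigwedge_{b\in B}b=\bigwedge_{b\in B}(a\multimap b)$. Set $a\otimes b:=\bigwedge_{c}((a\multimap b\multimap c)\multimap c)$. A linear separator is a subset $S$ that is upward closed, closed under modus ponens ($a\in S$, $(a\multimap b)\in S$ imply $b\in S$), and contains $\bigwedge_a(a\multimap a)$, $\bigwedge_{a,b,c}((b\multimap c)\multimap(a\multimap b)\multimap a\multimap c)$, $\bigwedge_{a,b,c}((a\multimap b\multimap c)\multimap b\multimap a\multimap c)$; $\mathrm{lcore}(\mathscr A)$ is the smallest linear separator. IMLL formulas: $A::=X\mid A\multimap A\mid A\otimes A$ ($X$ ranging over propositional variables). Sequents $\Gamma\vdash C$ have $\Gamma$ a finite multiset of formulas; rules: axiom $A\vdash A$; cut (from $\Gamma\vdash A$ and $\Delta,A\vdash C$ infer $\Gamma,\Delta\vdash C$); $\otimes$-R (from $\Gamma\vdash A$, $\Delta\vdash B$ infer $\Gamma,\Delta\vdash A\otimes B$); $\otimes$-L (from $\Gamma,A,B\vdash C$ infer $\Gamma,A\otimes B\vdash C$); $\multimap$-R (from $\Gamma,A\vdash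 B$ infer $\Gamma\vdash A\multimap B$); $\multimap$-L (from $\Gamma\vdash A$, $\Delta,B\vdash C$ infer $\Gamma,\Delta,A\multimap B\vdash C$). An interpretation assigns $X^{\mathscr A}\in\mathscr A$ to each variable and extends by $(A\multimap B)^{\mathscr A}=A^{\mathscr A}\multimap B^{\mathscr A}$, $(A\otimes B)^{\mathscr A}=A^{\mathscr A}\otimes B^{\mathscr A}$. -}

module Defs where

open import Level using (Level; _⊔_) renaming (suc to lsuc)
open import Data.Nat using (ℕ)
open import Data.List using (List; []; _∷_; _++_; [_])
open import Data.List.Relation.Binary.Permutation.Propositional using (_↭_)
open import Relation.Binary.PropositionalEquality using (_≡_)
open import Relation.Binary.Structures using (IsPartialOrder)


record ImplicativeStructure (ℓ : Level) : Set (lsuc ℓ) where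
  field
    Carrier : Set ℓ
    _≼_     : Carrier → Carrier → Set ℓ
    isPartialOrder : IsPartialOrder _≡_ _≼_
    ⋀       : {I : Set ℓ} → (I → Carrier) → Carrier
    ⋀-lb    : {I : Set ℓ} (f : I → Carrier) (i : I) → ⋀ f ≼ f i
    ⋀-glb   : {I : Set ℓ} (f : I → Carrier) (a : Carrier) →
              ((i : I) → a ≼ f i) → a ≼ ⋀ f
    _⊸_     : Carrier → Carrier → Carrier
    ⊸-mono  : ∀ {a a' b b'} → a' ≼ a → b ≼ b' → (a ⊸ b) ≼ (a' ⊸ b')
    ⊸-⋀     : {I : Set ℓ} (a : Carrier) (f : I → Carrier) →
              (a ⊸ ⋀ f) ≡ ⋀ (λ i → a ⊸ f i)

  infixr 6 _⊸_

  _⊗_ : Carrier → Carrier → Carrier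
  a ⊗ b = ⋀ (λ c → (a ⊸ b ⊸ c) ⊸ c)

  combI : Carrier
  combI = ⋀ (λ a → a ⊸ a)

  combB : Carrier
  combB = ⋀ (λ a → ⋀ (λ b → ⋀ (λ c → (b ⊸ c) ⊸ (a ⊸ b) ⊸ a ⊸ c)))

  combC : Carrier
  combC = ⋀ (λ a → ⋀ (λ b → ⋀ (λ c → (a ⊸ b ⊸ c) ⊸ b ⊸ a ⊸ c)))

  record IsLinearSeparator {ℓ'} (S : Carrier → Set ℓ') : Set (ℓ ⊔ ℓ') where
    field
      upward : ∀ {a b} → a ≼ b → S a → S b
      mp     : ∀ {a b} → S a → S (a ⊸ b) → S b
      hasI   : S combI
      hasB   : S combB
      hasC   : S combC

  -- lcore(A): the smallest linear separator, i.e. the intersection of all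
  -- linear separators (predicates on the carrier at level ℓ).
  lcore : Carrier → Set (lsuc ℓ)
  lcore a = (S : Carrier → Set ℓ) → IsLinearSeparator S → S a

data Formula : Set where
  var  : ℕ → Formula
  _⊸ᶠ_ : Formula → Formula → Formula
  _⊗ᶠ_ : Formula → Formula → Formula

infixr 6 _⊸ᶠ_ _⊗ᶠ_

-- Sequents Γ ⊢ C, with Γ a finite multiset represented as a list up to
-- permutation (the exchange rule makes contexts multisets).
infix 4 _⊢_
data _⊢_ : List Formula → Formula → Set where
  exch : ∀ {Γ Γ' C} → Γ ↭ Γ' → Γ ⊢ C → Γ' ⊢ C
  ax   : ∀ {A} → [ A ] ⊢ A
  cut  : ∀ {Γ Δ A C} → Γ ⊢ A → Δ ++ [ A ] ⊢ C → Γ ++ Δ ⊢ C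
  ⊗R   : ∀ {Γ Δ A B} → Γ ⊢ A → Δ ⊢ B → Γ ++ Δ ⊢ A ⊗ᶠ B
  ⊗L   : ∀ {Γ A B C} → Γ ++ A ∷ B ∷ [] ⊢ C → Γ ++ [ A ⊗ᶠ B ] ⊢ C
  ⊸R   : ∀ {Γ A B} → Γ ++ [ A ] ⊢ B → Γ ⊢ A ⊸ᶠ B
  ⊸L   : ∀ {Γ Δ A B C} → Γ ⊢ A → Δ ++ [ B ] ⊢ C → Γ ++ Δ ++ [ A ⊸ᶠ B ] ⊢ C

module _ {ℓ} (𝒜 : ImplicativeStructure ℓ) where
  open ImplicativeStructure 𝒜

  ⟦_⟧ : Formula → (ℕ → Carrier) → Carrier
  ⟦ var x ⟧   ρ = ρ x
  ⟦ A ⊸ᶠ B ⟧  ρ = ⟦ A ⟧ ρ ⊸ ⟦ B ⟧ ρ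
  ⟦ A ⊗ᶠ B ⟧  ρ = ⟦ A ⟧ ρ ⊗ ⟦ B ⟧ ρ

-- A sequent Γ ⊢ C is read as the curried implication ⟦Γ⟧ ⊸ … ⊸ ⟦C⟧, and every
-- rule of IMLL becomes an instance of modus ponens against a linear combinator
-- built from I, B and C, so each linear separator contains the reading of every
-- derivable sequent. The only uniformity issue is ⊗-introduction: a ⊗ b is a
-- meet over all c, and a separator is not closed under meets, so the pairing
-- map must be realised by the single element (B·C)·(C·I), where u·v is
-- application in the implicative structure.
module Submission where

open import Defs
open import Level using (Level)
open import Data.Nat using (ℕ)
open import Data.List using (List; []; _∷_; _++_; [_]; map; foldr)
open import Data.List.Properties using (map-++; foldr-++)
open import Data.List.Relation.Binary.Permutation.Propositional
  using (_↭_; refl; prep; swap; trans)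
open import Data.List.Relation.Binary.Permutation.Propositional.Properties using (map⁺)
open import Data.Product using (Σ-syntax; _,_; proj₁; proj₂)
open import Relation.Binary.PropositionalEquality as ≡ using (_≡_; cong; subst; sym)
open import Relation.Binary.Structures using (IsPartialOrder)

module ImplicativeStructureProperties {ℓ} (𝒜 : ImplicativeStructure ℓ) where
  open ImplicativeStructure 𝒜
  open IsPartialOrder isPartialOrder public
    using () renaming (refl to ≼-refl; trans to ≼-trans)

  ⋀³-lb : (f : Carrier → Carrier → Carrier → Carrier) (a b c : Carrier) →
          ⋀ (λ a → ⋀ (λ b → ⋀ (λ c → f a b c))) ≼ f a b c
  ⋀³-lb f a b c = ≼-trans (⋀-lb _ a) (≼-trans (⋀-lb _ b) (⋀-lb _ c))

  ≼⊸⋀ : ∀ {I : Set ℓ} {u a} (f : I → Carrier) → (∀ i → u ≼ (a ⊸ f i)) → u ≼ (a ⊸ ⋀ f)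
  ≼⊸⋀ {u = u} {a} f u≼ = subst (u ≼_) (sym (⊸-⋀ a f)) (⋀-glb _ u u≼)

  ≼⊸⊸⋀ : ∀ {I : Set ℓ} {u a b} (f : I → Carrier) →
         (∀ i → u ≼ (a ⊸ b ⊸ f i)) → u ≼ (a ⊸ b ⊸ ⋀ f)
  ≼⊸⊸⋀ {u = u} {a} {b} f u≼ = subst (λ t → u ≼ (a ⊸ t)) (sym (⊸-⋀ b f)) (≼⊸⋀ _ u≼)

  infixl 25 _·_
  _·_ : Carrier → Carrier → Carrier
  u · v = ⋀ {I = Σ[ w ∈ Carrier ] u ≼ (v ⊸ w)} proj₁

  ≼⊸· : ∀ u v → u ≼ (v ⊸ u · v)
  ≼⊸· u v = ≼⊸⋀ proj₁ proj₂

  ·-≼ : ∀ {u v v' w} → u ≼ (v' ⊸ w) → v ≼ v' → u · v ≼ w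
  ·-≼ {w = w} u≼ v≼ = ⋀-lb proj₁ (w , ≼-trans u≼ (⊸-mono v≼ ≼-refl))

  infixr 7 _⊸⋆_
  _⊸⋆_ : List Carrier → Carrier → Carrier
  as ⊸⋆ c = foldr _⊸_ c as

module LinearSeparatorProperties {ℓ ℓ'} (𝒜 : ImplicativeStructure ℓ)
    {S : ImplicativeStructure.Carrier 𝒜 → Set ℓ'}
    (sep : ImplicativeStructure.IsLinearSeparator 𝒜 S) where
  open ImplicativeStructure 𝒜
  open IsLinearSeparator sep
  open ImplicativeStructureProperties 𝒜

  I∈ : ∀ {a} → S (a ⊸ a)
  I∈ {a} = upward (⋀-lb _ a) hasI

  B∈ : ∀ {a b c} → S ((b ⊸ c) ⊸ (a ⊸ b) ⊸ a ⊸ c)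
  B∈ {a} {b} {c} = upward (⋀³-lb _ a b c) hasB

  C∈ : ∀ {a b c} → S ((a ⊸ b ⊸ c) ⊸ b ⊸ a ⊸ c)
  C∈ {a} {b} {c} = upward (⋀³-lb _ a b c) hasC

  ·-closed : ∀ {u v} → S u → S v → S (u · v)
  ·-closed {u} {v} u∈ v∈ = mp v∈ (upward (≼⊸· u v) u∈)

  postcompose∈ : ∀ {a b x} → S (a ⊸ b) → S ((x ⊸ a) ⊸ x ⊸ b)
  postcompose∈ f∈ = mp f∈ B∈

  ∘-closed : ∀ {a b c} → S (a ⊸ b) → S (b ⊸ c) → S (a ⊸ c)
  ∘-closed f∈ g∈ = mp f∈ (postcompose∈ g∈)

  eval∈ : ∀ {a b} → S (a ⊸ (a ⊸ b) ⊸ b)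
  eval∈ = mp I∈ C∈

  apply∈ : ∀ {a b c} → S (a ⊸ (b ⊸ c) ⊸ (a ⊸ b) ⊸ c)
  apply∈ = mp (∘-closed B∈ C∈) C∈

  ⊗-elim∈ : ∀ {a b c} → S ((a ⊸ b ⊸ c) ⊸ a ⊗ b ⊸ c)
  ⊗-elim∈ {a} {b} {c} = upward (⊸-mono ≼-refl (⊸-mono (⋀-lb _ c) ≼-refl)) eval∈

  pairing : Carrier
  pairing = combB · combC · (combC · combI)

  pairing∈ : S pairing
  pairing∈ = ·-closed (·-closed hasB hasC) (·-closed hasC hasI)

  pairing≼ : ∀ a b c → pairing ≼ (a ⊸ b ⊸ (a ⊸ b ⊸ c) ⊸ c)
  pairing≼ a b c = ·-≼ (·-≼ (⋀³-lb _ _ _ _) (⋀³-lb _ _ _ _))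
                       (·-≼ (⋀³-lb _ _ _ _) (⋀-lb _ (a ⊸ b ⊸ c)))

  pair∈ : ∀ a b → S (a ⊸ b ⊸ a ⊗ b)
  pair∈ a b = upward (≼⊸⊸⋀ _ (pairing≼ a b)) pairing∈

  ⊸⋆-map∈ : ∀ as {a d} → S ((a ⊸ d) ⊸ as ⊸⋆ a ⊸ as ⊸⋆ d)
  ⊸⋆-map∈ []       = I∈
  ⊸⋆-map∈ (_ ∷ as) = ∘-closed (⊸⋆-map∈ as) B∈

  ⊸⋆-map : ∀ as {a d} → S (a ⊸ d) → S (as ⊸⋆ a) → S (as ⊸⋆ d)
  ⊸⋆-map as f∈ x∈ = mp x∈ (mp f∈ (⊸⋆-map∈ as))

  ⊸⋆-map₂ : ∀ as bs {a b c} → S (a ⊸ b ⊸ c) → S (as ⊸⋆ a) → S (bs ⊸⋆ b) →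
            S (as ⊸⋆ bs ⊸⋆ c)
  ⊸⋆-map₂ as bs f∈ x∈ y∈ = ⊸⋆-map as (mp y∈ (mp (⊸⋆-map∈ bs) C∈)) (⊸⋆-map as f∈ x∈)

  ⊸⋆-↭ : ∀ {as bs} → as ↭ bs → ∀ {c} → S (as ⊸⋆ c ⊸ bs ⊸⋆ c)
  ⊸⋆-↭ refl          = I∈
  ⊸⋆-↭ (prep _ p)    = postcompose∈ (⊸⋆-↭ p)
  ⊸⋆-↭ (swap _ _ p)  = ∘-closed C∈ (postcompose∈ (postcompose∈ (⊸⋆-↭ p)))
  ⊸⋆-↭ (trans p q)   = ∘-closed (⊸⋆-↭ p) (⊸⋆-↭ q)

module Soundness {ℓ ℓ'} (𝒜 : ImplicativeStructure ℓ)
    (ρ : ℕ → ImplicativeStructure.Carrier 𝒜)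
    {S : ImplicativeStructure.Carrier 𝒜 → Set ℓ'}
    (sep : ImplicativeStructure.IsLinearSeparator 𝒜 S) where
  open ImplicativeStructure 𝒜
  open IsLinearSeparator sep
  open ImplicativeStructureProperties 𝒜
  open LinearSeparatorProperties 𝒜 sep

  ⟪_⟫ : Formula → Carrier
  ⟪ A ⟫ = ⟦_⟧ 𝒜 A ρ

  ⟪_⟫ˡ : List Formula → List Carrier
  ⟪ Γ ⟫ˡ = map ⟪_⟫ Γ

  ⟪++⟫ : ∀ Γ Δ c → ⟪ Γ ++ Δ ⟫ˡ ⊸⋆ c ≡ ⟪ Γ ⟫ˡ ⊸⋆ ⟪ Δ ⟫ˡ ⊸⋆ c
  ⟪++⟫ Γ Δ c = ≡.trans (cong (_⊸⋆ c) (map-++ ⟪_⟫ Γ Δ)) (foldr-++ _⊸_ c ⟪ Γ ⟫ˡ ⟪ Δ ⟫ˡ)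

  curry∈ : ∀ Γ {Δ c} → S (⟪ Γ ++ Δ ⟫ˡ ⊸⋆ c) → S (⟪ Γ ⟫ˡ ⊸⋆ ⟪ Δ ⟫ˡ ⊸⋆ c)
  curry∈ Γ {Δ} {c} = subst S (⟪++⟫ Γ Δ c)

  uncurry∈ : ∀ Γ {Δ c} → S (⟪ Γ ⟫ˡ ⊸⋆ ⟪ Δ ⟫ˡ ⊸⋆ c) → S (⟪ Γ ++ Δ ⟫ˡ ⊸⋆ c)
  uncurry∈ Γ {Δ} {c} = subst S (sym (⟪++⟫ Γ Δ c))

  sound : ∀ {Γ C} → Γ ⊢ C → S (⟪ Γ ⟫ˡ ⊸⋆ ⟪ C ⟫)
  sound (exch p d) = mp (sound d) (⊸⋆-↭ (map⁺ ⟪_⟫ p))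
  sound ax         = I∈
  sound (cut {Γ} {Δ} d e) =
    uncurry∈ Γ (⊸⋆-map₂ ⟪ Γ ⟫ˡ ⟪ Δ ⟫ˡ eval∈ (sound d) (curry∈ Δ (sound e)))
  sound (⊗R {Γ} {Δ} {A} {B} d e) =
    uncurry∈ Γ (⊸⋆-map₂ ⟪ Γ ⟫ˡ ⟪ Δ ⟫ˡ (pair∈ ⟪ A ⟫ ⟪ B ⟫) (sound d) (sound e))
  sound (⊗L {Γ} d) = uncurry∈ Γ (⊸⋆-map ⟪ Γ ⟫ˡ ⊗-elim∈ (curry∈ Γ (sound d)))
  sound (⊸R {Γ} d) = curry∈ Γ (sound d)
  sound (⊸L {Γ} {Δ} {A} {B} {C} d e) =
    uncurry∈ Γ (subst S (cong (⟪ Γ ⟫ˡ ⊸⋆_) (sym (⟪++⟫ Δ [ A ⊸ᶠ B ] ⟪ C ⟫)))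
                      (⊸⋆-map₂ ⟪ Γ ⟫ˡ ⟪ Δ ⟫ˡ apply∈ (sound d) (curry∈ Δ (sound e))))

proposition3p8 : ∀ {ℓ : Level} (𝒜 : ImplicativeStructure ℓ)
    (ρ : ℕ → ImplicativeStructure.Carrier 𝒜) (A : Formula) →
    [] ⊢ A → ImplicativeStructure.lcore 𝒜 (⟦_⟧ 𝒜 A ρ)
proposition3p8 𝒜 ρ A d S sep = Soundness.sound 𝒜 ρ sep d
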